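{- Let $p,q,M$ be positive integers such that $p/q\notin\mathbb{Z}$. If $t_1=pM$ and $t_2=pqM^2+M$, then $\lfloor t_1^2/t_2\rfloor=\lfloor p/q\rfloor$. -}

module Defs where

open import Data.Nat using (ℕ; suc; _+_; _*_; NonZero)
open import Data.Nat.Properties using (+-comm)
open import Relation.Binary.PropositionalEquality using (subst)

t₂-nonZero : ∀ p q M → .{{NonZero M}} → NonZero (p * q * (M * M) + M)
t₂-nonZero p q (suc m) = subst NonZero (+-comm (suc m) (p * q * (suc m * suc m))) _

module Submission where

-- Write p = r + k q with k = ⌊p/q⌋ and 1 ≤ r < q (r ≠ 0 because q ∤ p).
-- Upper bound: p < (k + 1) q gives t₁² = p · p M² < (k + 1) · p q M² ≤ (k + 1) t₂.
-- Lower bound: k t₂ = k · p q M² + k M, and the stray term k M is absorbed by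
-- r · p M², since k ≤ p and M ≤ M²; this leaves p (r + k q) M² = t₁².

open import Defs
open import Data.Nat using (ℕ; suc; _+_; _*_; _/_; _%_; _≤_; _<_; NonZero; ≢-nonZero)
open import Data.Nat.Divisibility using (_∣_; m%n≡0⇒n∣m)
open import Data.Nat.DivMod using (m≡m%n+[m/n]*n; m%n<n; m/n≤m; m<n*o⇒m/o<n; m*n/n≡m; /-monoˡ-≤)
open import Data.Nat.Properties
open import Data.Nat.Tactic.RingSolver using (solve-∀)
open import Relation.Nullary using (¬_)
open import Relation.Binary.PropositionalEquality using (_≡_; cong; sym; subst)

/-unique : ∀ {m n} k .{{_ : NonZero n}} → k * n ≤ m → m < suc k * n → m / n ≡ k
/-unique {m} {n} k lower upper = ≤-antisym
  (≤-pred (m<n*o⇒m/o<n upper))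
  (subst (_≤ m / n) (m*n/n≡m k n) (/-monoˡ-≤ n lower))

m<[1+m/n]*n : ∀ m n .{{_ : NonZero n}} → m < suc (m / n) * n
m<[1+m/n]*n m n = begin-strict
  m                   ≡⟨ m≡m%n+[m/n]*n m n ⟩
  m % n + m / n * n   <⟨ +-monoˡ-< (m / n * n) (m%n<n m n) ⟩
  n + m / n * n       ∎
  where open ≤-Reasoning

n∤m⇒m%n≢0 : ∀ {m n} .{{_ : NonZero n}} → ¬ (n ∣ m) → NonZero (m % n)
n∤m⇒m%n≢0 {m} {n} n∤m = ≢-nonZero (λ m%n≡0 → n∤m (m%n≡0⇒n∣m m n m%n≡0))

k*M≤r*[p*M²] : ∀ {k p} r M .{{_ : NonZero r}} .{{_ : NonZero M}} →
               k ≤ p → k * M ≤ r * (p * (M * M))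
k*M≤r*[p*M²] {k} {p} r M k≤p = begin
  k * M              ≤⟨ *-monoˡ-≤ M k≤p ⟩
  p * M              ≤⟨ *-monoʳ-≤ p (m≤m*n M M) ⟩
  p * (M * M)        ≤⟨ m≤n*m (p * (M * M)) r ⟩
  r * (p * (M * M))  ∎
  where open ≤-Reasoning

k*t₂≤t₁² : ∀ {p q k r M} .{{_ : NonZero r}} .{{_ : NonZero M}} →
           p ≡ r + k * q → k ≤ p →
           k * (p * q * (M * M) + M) ≤ p * M * (p * M)
k*t₂≤t₁² {p} {q} {k} {r} {M} p≡r+kq k≤p = begin
  k * (p * q * (M * M) + M)                  ≡⟨ *-distribˡ-+ k (p * q * (M * M)) M ⟩
  k * (p * q * (M * M)) + k * M              ≤⟨ +-monoʳ-≤ (k * (p * q * (M * M))) (k*M≤r*[p*M²] r M k≤p) ⟩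
  k * (p * q * (M * M)) + r * (p * (M * M))  ≡⟨ regroup p q k r M ⟩
  p * M * ((r + k * q) * M)                  ≡⟨ cong (λ x → p * M * (x * M)) (sym p≡r+kq) ⟩
  p * M * (p * M)                            ∎
  where
  open ≤-Reasoning
  regroup : ∀ p q k r M → k * (p * q * (M * M)) + r * (p * (M * M)) ≡ p * M * ((r + k * q) * M)
  regroup = solve-∀

t₁²<[1+k]*t₂ : ∀ {p q k M} .{{_ : NonZero p}} .{{_ : NonZero M}} →
               p < suc k * q → p * M * (p * M) < suc k * (p * q * (M * M) + M)
t₁²<[1+k]*t₂ {p} {q} {k} {M} p<[1+k]q = begin-strict
  p * M * (p * M)                ≡⟨ regroupˡ p M ⟩
  p * (p * (M * M))              <⟨ *-monoˡ-< (p * (M * M)) p<[1+k]q ⟩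
  suc k * q * (p * (M * M))      ≡⟨ regroupʳ p q (suc k) M ⟩
  suc k * (p * q * (M * M))      ≤⟨ *-monoʳ-≤ (suc k) (m≤m+n (p * q * (M * M)) M) ⟩
  suc k * (p * q * (M * M) + M)  ∎
  where
  open ≤-Reasoning
  regroupˡ : ∀ p M → p * M * (p * M) ≡ p * (p * (M * M))
  regroupˡ = solve-∀
  regroupʳ : ∀ p q k M → k * q * (p * (M * M)) ≡ k * (p * q * (M * M))
  regroupʳ = solve-∀
  instance
    M²≢0 : NonZero (M * M)
    M²≢0 = m*n≢0 M M
    pM²≢0 : NonZero (p * (M * M))
    pM²≢0 = m*n≢0 p (M * M)

lemma2p6 : ∀ (p q M : ℕ) → .{{_ : NonZero p}} → .{{_ : NonZero q}} → .{{_ : NonZero M}} →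
    ¬ (q ∣ p) →
    _/_ ((p * M) * (p * M)) (p * q * (M * M) + M) {{t₂-nonZero p q M}} ≡ p / q
lemma2p6 p q M q∤p = /-unique (p / q) {{t₂-nonZero p q M}}
  (k*t₂≤t₁² {{n∤m⇒m%n≢0 q∤p}} (m≡m%n+[m/n]*n p q) (m/n≤m p q))
  (t₁²<[1+k]*t₂ {k = p / q} (m<[1+m/n]*n p q))
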